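{- For integers $j\ge 1$ and $n$, let $D_j(n)=f_4\big(\sum_{i=0}^{j-1}2\cdot4^i+n\big)-b_4(n)$, and let $U_m=\sum_{i=0}^{m-1}4^i=[\underbrace{1\;\cdots\;1}_{m}]_4$. Then for every $j\ge1$, $$D_j(U_{j+1}+1)=D_j(-U_j-1)=-1.$$
   Context: For an integer $n$, a hyperquaternary representation of $n$ is an expression $n=\sum_{i\ge 0}\epsilon_i 4^i$ with finitely many nonzero $\epsilon_i$ and all $\epsilon_i\in\{0,1,2,3,4\}$; $f_4(n)$ denotes the number of such representations (so $f_4(n)=0$ for $n<0$). A balanced quaternary representation of $n$ is such an expression with all $\epsilon_i\in\{ -2,-1,0,1,2\}$; $b_4(n)$ denotes the number of such representations. Representations differing only by leading zeros are identified. -}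

module Defs where

open import Data.Nat as ℕ using (ℕ; zero; suc)
open import Data.Integer using (ℤ; +_; _+_; _*_; _-_; -_; _≤_)
open import Data.List using (List; []; _∷_; length; last)
open import Data.List.Relation.Unary.All using (All)
open import Data.List.Relation.Unary.Unique.Propositional using (Unique)
open import Data.List.Membership.Propositional using (_∈_)
open import Data.Maybe using (just)
open import Data.Product using (Σ; _×_)
open import Function.Bundles using (_⇔_)
open import Relation.Binary.PropositionalEquality using (_≡_; _≢_)

-- value of a digit list (least significant digit first): Σ ε_i 4^i
value : List ℤ → ℤ
value []       = + 0
value (d ∷ ds) = d + + 4 * value ds

-- no leading zeros (in the written sense): the most significant digit,
-- i.e. the last list element, is nonzero. This identifies representations
-- differing only by leading zeros.
NoLeadingZeros : List ℤ → Set
NoLeadingZeros ds = ∀ d → last ds ≡ just d → d ≢ + 0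

HyperRep : ℤ → List ℤ → Set
HyperRep n ds = All (λ d → (+ 0 ≤ d) × (d ≤ + 4)) ds × NoLeadingZeros ds × value ds ≡ n

BalRep : ℤ → List ℤ → Set
BalRep n ds = All (λ d → (- + 2 ≤ d) × (d ≤ + 2)) ds × NoLeadingZeros ds × value ds ≡ n

NumberOf : (List ℤ → Set) → ℕ → Set
NumberOf P c = Σ (List (List ℤ)) λ l → Unique l × (∀ ds → (ds ∈ l) ⇔ P ds) × length l ≡ c

f4≡ : ℤ → ℕ → Set
f4≡ n c = NumberOf (HyperRep n) c

b4≡ : ℤ → ℕ → Set
b4≡ n c = NumberOf (BalRep n) c

U : ℕ → ℤ
U zero    = + 0
U (suc m) = U m + + (4 ℕ.^ m)

T : ℕ → ℤ
T j = + 2 * U j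

D≡ : ℕ → ℤ → ℤ → Set
D≡ j n d = Σ ℕ λ a → Σ ℕ λ b → f4≡ (T j + n) a × b4≡ n b × (+ a - + b ≡ d)

{-# OPTIONS --safe #-}
-- In a window {a, …, a + 4} of five consecutive digits, the lowest digit d of a base-4
-- representation of n ≢ 0 satisfies d ≡ n (mod 4) and the other digits represent (n − d)/4,
-- so d is forced unless n ≡ a (mod 4), when it is a or a + 4. For the digit sets {0, …, 4}
-- and {−2, …, 2} this gives the recurrences
--   f₄(4m + r) = f₄(m) for r = 1, 2, 3,    f₄(4m) = f₄(m) + f₄(m − 1),
--   b₄(4m + r) = b₄(m) for r = ±1,         b₄(4m − 2) = b₄(m) + b₄(m − 1).
-- Unwound along the base-4 expansions of T_j + U_{j+1} + 1 = 2·4^j, T_j − U_j − 1 = U_j − 1,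
-- U_{j+1} + 1 and −U_j − 1 they give f₄ = j + 1, j and b₄ = j + 2, j + 1 respectively.
module Submission where

open import Defs
open import Data.Nat using (ℕ; suc; _≤_)
open import Data.Integer using (+_; _+_; _-_; -_; -[1+_])
open import Data.Product using (_×_)

import Data.Nat as ℕ
import Data.Nat.Properties as ℕ
open import Data.Nat.Base using (zero; z≤n; s≤s)
import Data.Integer as ℤ
import Data.Integer.Properties as ℤ
open import Data.Integer using (ℤ; _*_; +<+; -<-)
open import Data.Integer.Divisibility.Signed using (_∣_; _∣?_; divides; ∣-refl; ∣m⇒∣m*n; ∣m+n∣n⇒∣m)
open import Data.Integer.Tactic.RingSolver using (solve-∀)
open import Data.List using (List; []; _∷_; map; _++_)
open import Data.List.Properties using (length-map; length-++; ∷-injectiveʳ)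
open import Data.List.Relation.Unary.All using (All; []; _∷_)
open import Data.List.Relation.Unary.Any using (here)
open import Data.List.Relation.Unary.Unique.Propositional using ([]; _∷_)
import Data.List.Relation.Unary.Unique.Propositional.Properties as Unique
open import Data.List.Membership.Propositional using (_∈_)
open import Data.List.Membership.Propositional.Properties
  using (∈-map⁺; ∈-map⁻; ∈-++⁺ˡ; ∈-++⁺ʳ; ∈-++⁻)
open import Data.Product using (_,_; proj₁; proj₂)
open import Data.Sum using (_⊎_; inj₁; inj₂)
open import Data.Empty using (⊥; ⊥-elim)
open import Function.Base using (_∘_)
open import Function.Bundles using (mk⇔; Equivalence)
open import Relation.Nullary using (¬_)
open import Relation.Nullary.Decidable using (True; False; toWitness; toWitnessFalse; from-no)
open import Relation.Unary using (Pred; _≐_; _∪_)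
open import Relation.Binary.PropositionalEquality
  using (_≡_; _≢_; refl; sym; trans; cong; cong₂; subst; subst₂; module ≡-Reasoning)

open Equivalence using (to; from)

private
  variable
    a d m n r : ℤ
    c c′ : ℕ
    ds : List ℤ
    P Q : Pred (List ℤ) _

infixr 7 _∷ᵖ_

_∷ᵖ_ : ℤ → Pred (List ℤ) _ → Pred (List ℤ) _
(a ∷ᵖ P) []       = ⊥
(a ∷ᵖ P) (d ∷ ds) = d ≡ a × P ds

NumberOf-resp : P ≐ Q → NumberOf P c → NumberOf Q c
NumberOf-resp (P⊆Q , Q⊆P) (l , u , l≐P , len) =
  l , u , (λ ds → mk⇔ (P⊆Q ∘ to (l≐P ds)) (from (l≐P ds) ∘ Q⊆P)) , len

NumberOf-≡ : (xs : List ℤ) → NumberOf (_≡ xs) 1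
NumberOf-≡ xs = xs ∷ [] , [] ∷ [] , (λ ds → mk⇔ here-≡ here) , refl
  where
  here-≡ : ∀ {ds} → ds ∈ xs ∷ [] → ds ≡ xs
  here-≡ (here ds≡xs) = ds≡xs

NumberOf-∷ᵖ : ∀ a → NumberOf P c → NumberOf (a ∷ᵖ P) c
NumberOf-∷ᵖ {P} a (l , u , l≐P , len) =
  map (a ∷_) l , Unique.map⁺ ∷-injectiveʳ u , (λ ds → mk⇔ (mem⇒ ds) (⇒mem ds)) ,
  trans (length-map _ l) len
  where
  mem⇒ : ∀ ds → ds ∈ map (a ∷_) l → (a ∷ᵖ P) ds
  mem⇒ ds ds∈ with ∈-map⁻ (a ∷_) ds∈
  ... | es , es∈l , refl = refl , to (l≐P es) es∈l
  ⇒mem : ∀ ds → (a ∷ᵖ P) ds → ds ∈ map (a ∷_) l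
  ⇒mem (_ ∷ es) (refl , p) = ∈-map⁺ (a ∷_) (from (l≐P es) p)

NumberOf-∪ : (∀ {ds} → P ds → ¬ Q ds) → NumberOf P c → NumberOf Q c′ → NumberOf (P ∪ Q) (c ℕ.+ c′)
NumberOf-∪ {P} {Q} P∩Q=∅ (l , u , l≐P , len) (l′ , u′ , l′≐Q , len′) =
  l ++ l′ , Unique.++⁺ u u′ disjoint , (λ ds → mk⇔ (mem⇒ ds) (⇒mem ds)) ,
  trans (length-++ l) (cong₂ ℕ._+_ len len′)
  where
  disjoint : ∀ {ds} → ds ∈ l × ds ∈ l′ → ⊥
  disjoint {ds} (∈l , ∈l′) = P∩Q=∅ (to (l≐P ds) ∈l) (to (l′≐Q ds) ∈l′)
  mem⇒ : ∀ ds → ds ∈ l ++ l′ → (P ∪ Q) ds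
  mem⇒ ds ds∈ with ∈-++⁻ l ds∈
  ... | inj₁ ∈l  = inj₁ (to (l≐P ds) ∈l)
  ... | inj₂ ∈l′ = inj₂ (to (l′≐Q ds) ∈l′)
  ⇒mem : ∀ ds → (P ∪ Q) ds → ds ∈ l ++ l′
  ⇒mem ds (inj₁ p) = ∈-++⁺ˡ (from (l≐P ds) p)
  ⇒mem ds (inj₂ q) = ∈-++⁺ʳ l (from (l′≐Q ds) q)

-- The lowest digit in a window of five consecutive digits

Window : ℤ → ℤ → Set
Window a d = a ℤ.≤ d × d ℤ.≤ a + + 4

i-j≡k⇒i≡j+k : ∀ i j {k} → i - j ≡ k → i ≡ j + k
i-j≡k⇒i≡j+k i j refl = identity i j
  where
  identity : ∀ i j → i ≡ j + (i - j)
  identity = solve-∀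

i-j≡k⇒j≡i-k : ∀ i j {k} → i - j ≡ k → j ≡ i - k
i-j≡k⇒j≡i-k i j refl = identity i j
  where
  identity : ∀ i j → j ≡ i - (i - j)
  identity = solve-∀

+-cancelʳ-≤ : ∀ {i j} k → i + k ℤ.≤ j + k → i ℤ.≤ j
+-cancelʳ-≤ {i} {j} k le = subst₂ ℤ._≤_ (cancel i k) (cancel j k) (ℤ.+-monoˡ-≤ (- k) le)
  where
  cancel : ∀ x k → (x + k) - k ≡ x
  cancel = solve-∀

a<a+4 : ∀ a → a ℤ.< a + + 4
a<a+4 a = subst (ℤ._< a + + 4) (ℤ.+-identityʳ a) (ℤ.+-monoʳ-< a (+<+ (s≤s z≤n)))

digit-difference : ∀ {d r v m} → d + + 4 * v ≡ r + + 4 * m → d - r ≡ + 4 * (m - v)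
digit-difference {d} {r} {v} {m} eq = begin
  d - r                                                  ≡⟨ regroup d r v m ⟩
  ((d + + 4 * v) - (r + + 4 * m)) + + 4 * (m - v)        ≡⟨ cong (λ x → (x - (r + + 4 * m)) + + 4 * (m - v)) eq ⟩
  ((r + + 4 * m) - (r + + 4 * m)) + + 4 * (m - v)        ≡⟨ cong (_+ + 4 * (m - v)) (ℤ.+-inverseʳ (r + + 4 * m)) ⟩
  + 0 + + 4 * (m - v)                                    ≡⟨ ℤ.+-identityˡ _ ⟩
  + 4 * (m - v)                                          ∎
  where
  open ≡-Reasoning
  regroup : ∀ d r v m → d - r ≡ ((d + + 4 * v) - (r + + 4 * m)) + + 4 * (m - v)
  regroup = solve-∀

digit-gap-bounds : Window a d → a ℤ.≤ r → r ℤ.< a + + 4 → -[1+ 3 ] ℤ.< d - r × d - r ℤ.≤ + 4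
digit-gap-bounds {a} {d} {r} (a≤d , d≤a+4) a≤r r<a+4 =
  subst (ℤ._< d - r) (lower a) (ℤ.+-mono-≤-< a≤d (ℤ.neg-mono-< r<a+4)) ,
  subst (d - r ℤ.≤_) (upper a) (ℤ.+-mono-≤ d≤a+4 (ℤ.neg-mono-≤ a≤r))
  where
  lower : ∀ a → a - (a + + 4) ≡ -[1+ 3 ]
  lower = solve-∀
  upper : ∀ a → (a + + 4) - a ≡ + 4
  upper = solve-∀

-1<i≤1⇒i≡0⊎i≡1 : ∀ {i} → -[1+ 0 ] ℤ.< i → i ℤ.≤ + 1 → i ≡ + 0 ⊎ i ≡ + 1
-1<i≤1⇒i≡0⊎i≡1 {+ 0}           _        _                 = inj₁ refl
-1<i≤1⇒i≡0⊎i≡1 {+ 1}           _        _                 = inj₂ refl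
-1<i≤1⇒i≡0⊎i≡1 {+ suc (suc _)} _        (ℤ.+≤+ (s≤s ()))
-1<i≤1⇒i≡0⊎i≡1 { -[1+ _ ]}     (-<- ()) _

window-carry : ∀ {q} → Window a d → a ℤ.≤ r → r ℤ.< a + + 4 → d - r ≡ + 4 * q → q ≡ + 0 ⊎ q ≡ + 1
window-carry {q = q} w a≤r r<a+4 gap with digit-gap-bounds w a≤r r<a+4
... | lower , upper = -1<i≤1⇒i≡0⊎i≡1
  (ℤ.*-cancelˡ-<-nonNeg (+ 4) (subst (-[1+ 3 ] ℤ.<_) gap lower))
  (ℤ.*-cancelˡ-≤-pos q (+ 1) (+ 4) (subst (ℤ._≤ + 4) gap upper))

window-digit : ∀ {v m} → Window a d → a ℤ.≤ r → r ℤ.< a + + 4 → d + + 4 * v ≡ r + + 4 * m →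
               d ≡ r × v ≡ m ⊎ r ≡ a × d ≡ a + + 4 × v ≡ m - + 1
window-digit {a} {d} {r} {v} {m} w@(_ , d≤a+4) a≤r r<a+4 eq = by-carry (window-carry w a≤r r<a+4 gap)
  where
  gap : d - r ≡ + 4 * (m - v)
  gap = digit-difference {d} {r} {v} {m} eq
  by-carry : m - v ≡ + 0 ⊎ m - v ≡ + 1 → d ≡ r × v ≡ m ⊎ r ≡ a × d ≡ a + + 4 × v ≡ m - + 1
  by-carry (inj₁ m-v≡0) = inj₁ (ℤ.i-j≡0⇒i≡j d r (trans gap (cong (+ 4 *_) m-v≡0)) , sym (ℤ.i-j≡0⇒i≡j m v m-v≡0))
  by-carry (inj₂ m-v≡1) = inj₂ (r≡a , trans d≡r+4 (cong (_+ + 4) r≡a) , i-j≡k⇒j≡i-k m v m-v≡1)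
    where
    d≡r+4 : d ≡ r + + 4
    d≡r+4 = i-j≡k⇒i≡j+k d r (trans gap (cong (+ 4 *_) m-v≡1))
    r≡a : r ≡ a
    r≡a = ℤ.≤-antisym (+-cancelʳ-≤ (+ 4) (subst (ℤ._≤ a + + 4) d≡r+4 d≤a+4)) a≤r

r+4m≢0 : ∀ m → ¬ (+ 4 ∣ r) → r + + 4 * m ≢ + 0
r+4m≢0 m 4∤r r+4m≡0 =
  4∤r (∣m+n∣n⇒∣m (subst (+ 4 ∣_) (sym r+4m≡0) (divides (+ 0) refl)) (∣m⇒∣m*n m ∣-refl))

4m≢0 : m ≢ + 0 → + 0 + + 4 * m ≢ + 0
4m≢0 {m} m≢0 4m≡0 with ℤ.i*j≡0⇒i≡0∨j≡0 (+ 4) (trans (sym (ℤ.+-identityˡ (+ 4 * m))) 4m≡0)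
... | inj₁ ()
... | inj₂ m≡0 = m≢0 m≡0

-- f4≡ and b4≡ count Rep (+ 0) and Rep (- + 2), up to unfolding.
Rep : ℤ → ℤ → List ℤ → Set
Rep a n ds = All (Window a) ds × NoLeadingZeros ds × value ds ≡ n

Rep-resp : m ≡ n → Rep a m ds → Rep a n ds
Rep-resp m≡n (ws , nlz , eq) = ws , nlz , trans eq m≡n

Rep-[] : Rep a n [] → n ≡ + 0
Rep-[] (_ , _ , eq) = sym eq

Rep-∷⁻ : Rep a n (d ∷ ds) → Window a d × d + + 4 * value ds ≡ n × Rep a (value ds) ds
Rep-∷⁻ {ds = []}    (w ∷ ws , _   , eq) = w , eq , ws , (λ _ ()) , refl
Rep-∷⁻ {ds = _ ∷ _} (w ∷ ws , nlz , eq) = w , eq , ws , nlz , refl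

Rep-∷⁺ : n ≢ + 0 → Window a d → n ≡ d + + 4 * m → Rep a m ds → Rep a n (d ∷ ds)
Rep-∷⁺ {ds = []}    n≢0 w n≡ (_ , _ , refl)   = w ∷ [] , (λ { _ refl refl → n≢0 n≡ }) , sym n≡
Rep-∷⁺ {ds = _ ∷ _} _   w n≡ (ws , nlz , refl) = w ∷ ws , nlz , sym n≡

Rep-∷-inner : a ℤ.< r → r ℤ.< a + + 4 → n ≡ r + + 4 * m → Rep a n (d ∷ ds) → (r ∷ᵖ Rep a m) (d ∷ ds)
Rep-∷-inner a<r r<a+4 n≡ rep with Rep-∷⁻ rep
... | w , eq , rep′ with window-digit w (ℤ.<⇒≤ a<r) r<a+4 (trans eq n≡)
...   | inj₁ (d≡r , v≡m) = d≡r , Rep-resp v≡m rep′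
...   | inj₂ (r≡a , _)   = ⊥-elim (ℤ.<⇒≢ a<r (sym r≡a))

Rep-∷-boundary : n ≡ a + + 4 * m → Rep a n (d ∷ ds) →
                 (a ∷ᵖ Rep a m ∪ (a + + 4) ∷ᵖ Rep a (m - + 1)) (d ∷ ds)
Rep-∷-boundary {a = a} n≡ rep with Rep-∷⁻ rep
... | w , eq , rep′ with window-digit w ℤ.≤-refl (a<a+4 a) (trans eq n≡)
...   | inj₁ (d≡a , v≡m)         = inj₁ (d≡a , Rep-resp v≡m rep′)
...   | inj₂ (_ , d≡a+4 , v≡m-1) = inj₂ (d≡a+4 , Rep-resp v≡m-1 rep′)

-- 4 ∤ r rules out n = 0, whose only representation is [].
count-inner : ∀ r {a<r : True (a ℤ.<? r)} {r<a+4 : True (r ℤ.<? a + + 4)} {4∤r : False (+ 4 ∣? r)} →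
              n ≡ r + + 4 * m → NumberOf (Rep a m) c → NumberOf (Rep a n) c
count-inner {a} {n} {m} r {a<r} {r<a+4} {4∤r} n≡ =
  NumberOf-resp (cons , uncons) ∘ NumberOf-∷ᵖ r
  where
  n≢0 = r+4m≢0 m (toWitnessFalse 4∤r) ∘ trans (sym n≡)
  cons : ∀ {ds} → (r ∷ᵖ Rep a m) ds → Rep a n ds
  cons {_ ∷ _} (refl , rep) = Rep-∷⁺ n≢0 (ℤ.<⇒≤ (toWitness a<r) , ℤ.<⇒≤ (toWitness r<a+4)) n≡ rep
  uncons : ∀ {ds} → Rep a n ds → (r ∷ᵖ Rep a m) ds
  uncons {[]}    rep = ⊥-elim (n≢0 (Rep-[] rep))
  uncons {_ ∷ _} rep = Rep-∷-inner (toWitness a<r) (toWitness r<a+4) n≡ rep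

count-boundary : n ≡ a + + 4 * m → a + + 4 * m ≢ + 0 →
                 NumberOf (Rep a m) c → NumberOf (Rep a (m - + 1)) c′ → NumberOf (Rep a n) (c ℕ.+ c′)
count-boundary {n} {a} {m} n≡ ≢0 N N′ =
  NumberOf-resp (cons , uncons) (NumberOf-∪ distinct (NumberOf-∷ᵖ a N) (NumberOf-∷ᵖ (a + + 4) N′))
  where
  n≢0 = ≢0 ∘ trans (sym n≡)
  a≤a+4 = ℤ.<⇒≤ (a<a+4 a)
  carry : ∀ a m → a + + 4 * m ≡ (a + + 4) + + 4 * (m - + 1)
  carry = solve-∀
  distinct : ∀ {ds} → (a ∷ᵖ Rep a m) ds → ¬ ((a + + 4) ∷ᵖ Rep a (m - + 1)) ds
  distinct {_ ∷ _} (refl , _) (a≡a+4 , _) = ℤ.<⇒≢ (a<a+4 a) a≡a+4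
  cons : ∀ {ds} → (a ∷ᵖ Rep a m ∪ (a + + 4) ∷ᵖ Rep a (m - + 1)) ds → Rep a n ds
  cons {_ ∷ _} (inj₁ (refl , rep)) = Rep-∷⁺ n≢0 (ℤ.≤-refl , a≤a+4) n≡ rep
  cons {_ ∷ _} (inj₂ (refl , rep)) = Rep-∷⁺ n≢0 (a≤a+4 , ℤ.≤-refl) (trans n≡ (carry a m)) rep
  uncons : ∀ {ds} → Rep a n ds → (a ∷ᵖ Rep a m ∪ (a + + 4) ∷ᵖ Rep a (m - + 1)) ds
  uncons {[]}    rep = ⊥-elim (n≢0 (Rep-[] rep))
  uncons {_ ∷ _} rep = Rep-∷-boundary n≡ rep

Rep-fixed-point : ∀ r {a<r : True (a ℤ.<? r)} {r<a+4 : True (r ℤ.<? a + + 4)} →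
                  n ≡ r + + 4 * n → Rep a n ds → ds ≡ []
Rep-fixed-point {ds = []} _ _ _ = refl
Rep-fixed-point {n = n} {ds = d ∷ _} r {a<r} {r<a+4} n≡ rep
  with Rep-∷-inner (toWitness a<r) (toWitness r<a+4) n≡ rep
... | d≡r , rep′ with Rep-fixed-point r {a<r} {r<a+4} n≡ rep′
...   | refl = ⊥-elim (proj₁ (proj₂ rep) d refl (trans d≡r r≡0))
  where
  open ≡-Reasoning
  r≡0 : r ≡ + 0
  r≡0 = begin
    r                ≡⟨ ℤ.+-identityʳ r ⟨
    r + + 4 * + 0    ≡⟨ cong (λ x → r + + 4 * x) (Rep-[] rep′) ⟨
    r + + 4 * n      ≡⟨ n≡ ⟨
    n                ≡⟨ Rep-[] rep′ ⟩
    + 0              ∎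

count-zero : (∀ {ds} → Rep a (+ 0) ds → ds ≡ []) → NumberOf (Rep a (+ 0)) 1
count-zero only-[] = NumberOf-resp ((λ { refl → [] , (λ _ ()) , refl }) , only-[]) (NumberOf-≡ [])

-- Base-4 expansions of the numbers involved

4^_ : ℕ → ℤ
4^ k = + (4 ℕ.^ k)

4^-suc : ∀ k → 4^ suc k ≡ + 4 * 4^ k
4^-suc k = ℤ.pos-* 4 (4 ℕ.^ k)

3*U+1≡4^ : ∀ k → + 3 * U k + + 1 ≡ 4^ k
3*U+1≡4^ zero    = refl
3*U+1≡4^ (suc k) = begin
  + 3 * (U k + 4^ k) + + 1          ≡⟨ regroup (U k) (4^ k) ⟩
  (+ 3 * U k + + 1) + + 3 * 4^ k    ≡⟨ cong (_+ + 3 * 4^ k) (3*U+1≡4^ k) ⟩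
  4^ k + + 3 * 4^ k                 ≡⟨ collect (4^ k) ⟩
  + 4 * 4^ k                        ≡⟨ 4^-suc k ⟨
  4^ suc k                          ∎
  where
  open ≡-Reasoning
  regroup : ∀ u p → + 3 * (u + p) + + 1 ≡ (+ 3 * u + + 1) + + 3 * p
  regroup = solve-∀
  collect : ∀ p → p + + 3 * p ≡ + 4 * p
  collect = solve-∀

U[1+k]≡1+4*U[k] : ∀ k → U (suc k) ≡ + 1 + + 4 * U k
U[1+k]≡1+4*U[k] k = trans (cong (λ x → U k + x) (sym (3*U+1≡4^ k))) (regroup (U k))
  where
  regroup : ∀ u → u + (+ 3 * u + + 1) ≡ + 1 + + 4 * u
  regroup = solve-∀

U-expansion : (f g : ℤ → ℤ) → (∀ u → f (+ 1 + + 4 * u) ≡ g u) → ∀ k → f (U (suc k)) ≡ g (U k)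
U-expansion f g identity k = trans (cong f (U[1+k]≡1+4*U[k] k)) (identity (U k))

U[2+k]-1≡0+4*U[1+k] : ∀ k → U (suc (suc k)) - + 1 ≡ + 0 + + 4 * U (suc k)
U[2+k]-1≡0+4*U[1+k] k = U-expansion (_- + 1) (λ u → + 0 + + 4 * u) solve-∀ (suc k)

U[1+k]+1≡-2+4*[U[k]+1] : ∀ k → U (suc k) + + 1 ≡ -[1+ 1 ] + + 4 * (U k + + 1)
U[1+k]+1≡-2+4*[U[k]+1] = U-expansion (_+ + 1) (λ u → -[1+ 1 ] + + 4 * (u + + 1)) solve-∀

-U[1+k]≡-1+4*-U[k] : ∀ k → - U (suc k) ≡ -[1+ 0 ] + + 4 * (- U k)
-U[1+k]≡-1+4*-U[k] = U-expansion -_ (λ u → -[1+ 0 ] + + 4 * (- u)) solve-∀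

-U[1+k]-1≡-2+4*-U[k] : ∀ k → (- U (suc k)) - + 1 ≡ -[1+ 1 ] + + 4 * (- U k)
-U[1+k]-1≡-2+4*-U[k] = U-expansion (λ u → (- u) - + 1) (λ u → -[1+ 1 ] + + 4 * (- u)) solve-∀

4^-expansion : (f g : ℤ → ℤ) → (∀ p → f (+ 4 * p) ≡ g p) → ∀ k → f (4^ suc k) ≡ g (4^ k)
4^-expansion f g identity k = trans (cong f (4^-suc k)) (identity (4^ k))

2*4^[1+k]≡0+4*[2*4^k] : ∀ k → + 2 * 4^ suc k ≡ + 0 + + 4 * (+ 2 * 4^ k)
2*4^[1+k]≡0+4*[2*4^k] = 4^-expansion (+ 2 *_) (λ p → + 0 + + 4 * (+ 2 * p)) solve-∀

2*4^[1+k]-1≡3+4*[2*4^k-1] : ∀ k → + 2 * 4^ suc k - + 1 ≡ + 3 + + 4 * (+ 2 * 4^ k - + 1)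
2*4^[1+k]-1≡3+4*[2*4^k-1] = 4^-expansion (λ p → + 2 * p - + 1) (λ p → + 3 + + 4 * (+ 2 * p - + 1)) solve-∀

T+U[1+j]+1≡2*4^j : ∀ j → T j + (U (suc j) + + 1) ≡ + 2 * 4^ j
T+U[1+j]+1≡2*4^j j = begin
  + 2 * U j + ((U j + 4^ j) + + 1)   ≡⟨ regroup (U j) (4^ j) ⟩
  (+ 3 * U j + + 1) + 4^ j           ≡⟨ cong (_+ 4^ j) (3*U+1≡4^ j) ⟩
  4^ j + 4^ j                        ≡⟨ double (4^ j) ⟩
  + 2 * 4^ j                         ∎
  where
  open ≡-Reasoning
  regroup : ∀ u p → + 2 * u + ((u + p) + + 1) ≡ (+ 3 * u + + 1) + p
  regroup = solve-∀
  double : ∀ p → p + p ≡ + 2 * p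
  double = solve-∀

T-U-1≡U-1 : ∀ j → T j + ((- U j) - + 1) ≡ U j - + 1
T-U-1≡U-1 j = identity (U j)
  where
  identity : ∀ u → + 2 * u + ((- u) - + 1) ≡ u - + 1
  identity = solve-∀

U[1+k]≢0 : ∀ k → U (suc k) ≢ + 0
U[1+k]≢0 k = r+4m≢0 (U k) (from-no (+ 4 ∣? + 1)) ∘ trans (sym (U[1+k]≡1+4*U[k] k))

2*4^k≢0 : ∀ k → + 2 * 4^ k ≢ + 0
2*4^k≢0 zero    = λ ()
2*4^k≢0 (suc k) = 4m≢0 (2*4^k≢0 k) ∘ trans (sym (2*4^[1+k]≡0+4*[2*4^k] k))

f4-zero : f4≡ (+ 0) 1
f4-zero = count-zero only-[]
  where
  -- 0 = 4 + 4·(−1) is no alternative: −1 = 3 + 4·(−1) has no representation.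
  only-[] : ∀ {ds} → Rep (+ 0) (+ 0) ds → ds ≡ []
  only-[] {[]}    _   = refl
  only-[] {d ∷ _} rep with Rep-∷-boundary refl rep
  ... | inj₁ (d≡0 , rep′) with only-[] rep′
  ...   | refl = ⊥-elim (proj₁ (proj₂ rep) d refl d≡0)
  only-[] {d ∷ _} rep | inj₂ (_ , rep′) with Rep-fixed-point (+ 3) refl rep′
  ...   | refl with Rep-[] rep′
  ...     | ()

f4-U : ∀ k → f4≡ (U k) 1
f4-U zero    = f4-zero
f4-U (suc k) = count-inner (+ 1) (U[1+k]≡1+4*U[k] k) (f4-U k)

f4-U[1+k]-1 : ∀ k → f4≡ (U (suc k) - + 1) (suc k)
f4-U[1+k]-1 zero    = f4-zero
f4-U[1+k]-1 (suc k) =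
  count-boundary (U[2+k]-1≡0+4*U[1+k] k) (4m≢0 (U[1+k]≢0 k)) (f4-U (suc k)) (f4-U[1+k]-1 k)

f4-2*4^k-1 : ∀ k → f4≡ (+ 2 * 4^ k - + 1) 1
f4-2*4^k-1 zero    = count-inner (+ 1) refl f4-zero
f4-2*4^k-1 (suc k) =
  count-inner (+ 3) (2*4^[1+k]-1≡3+4*[2*4^k-1] k) (f4-2*4^k-1 k)

f4-2*4^k : ∀ k → f4≡ (+ 2 * 4^ k) (suc k)
f4-2*4^k zero    = count-inner (+ 2) refl f4-zero
f4-2*4^k (suc k) = subst (f4≡ (+ 2 * 4^ suc k)) (ℕ.+-comm (suc k) 1)
  (count-boundary (2*4^[1+k]≡0+4*[2*4^k] k) (4m≢0 (2*4^k≢0 k)) (f4-2*4^k k) (f4-2*4^k-1 k))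

b4-zero : b4≡ (+ 0) 1
b4-zero = count-zero (Rep-fixed-point (+ 0) refl)

b4-U : ∀ k → b4≡ (U k) 1
b4-U zero    = b4-zero
b4-U (suc k) = count-inner (+ 1) (U[1+k]≡1+4*U[k] k) (b4-U k)

b4-U+1 : ∀ k → b4≡ (U k + + 1) (suc k)
b4-U+1 zero    = count-inner (+ 1) refl b4-zero
b4-U+1 (suc k) = subst (b4≡ (U (suc k) + + 1)) (ℕ.+-comm (suc k) 1)
  (count-boundary (U[1+k]+1≡-2+4*[U[k]+1] k) (r+4m≢0 (U k + + 1) (from-no (+ 4 ∣? -[1+ 1 ])))
    (b4-U+1 k) (subst (λ n → b4≡ n 1) (sym (u+1-1≡u (U k))) (b4-U k)))
  where
  u+1-1≡u : ∀ u → (u + + 1) - + 1 ≡ u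
  u+1-1≡u = solve-∀

b4--U : ∀ k → b4≡ (- U k) 1
b4--U zero    = b4-zero
b4--U (suc k) = count-inner -[1+ 0 ] (-U[1+k]≡-1+4*-U[k] k) (b4--U k)

b4--U-1 : ∀ k → b4≡ ((- U k) - + 1) (suc k)
b4--U-1 zero    = count-inner -[1+ 0 ] refl b4-zero
b4--U-1 (suc k) =
  count-boundary (-U[1+k]-1≡-2+4*-U[k] k) (r+4m≢0 (- U k) (from-no (+ 4 ∣? -[1+ 1 ]))) (b4--U k) (b4--U-1 k)

n-[1+n]≡-1 : ∀ n → + n - + suc n ≡ -[1+ 0 ]
n-[1+n]≡-1 zero    = refl
n-[1+n]≡-1 (suc n) = trans (ℤ.[1+m]⊖[1+n]≡m⊖n n (suc n)) (n-[1+n]≡-1 n)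

D≡-1 : ∀ j {n c} → f4≡ (T j + n) c → b4≡ n (suc c) → D≡ j n -[1+ 0 ]
D≡-1 _ {c = c} f4 b4 = c , suc c , f4 , b4 , n-[1+n]≡-1 c

lemma3p3 : (j : ℕ) → 1 ≤ j →
    D≡ j (U (suc j) + + 1) -[1+ 0 ] × D≡ j ((- U j) - + 1) -[1+ 0 ]
lemma3p3 (suc k) (s≤s z≤n) =
  D≡-1 (suc k) (subst (λ n → f4≡ n (suc (suc k))) (sym (T+U[1+j]+1≡2*4^j (suc k))) (f4-2*4^k (suc k)))
                (b4-U+1 (suc (suc k))) ,
  D≡-1 (suc k) (subst (λ n → f4≡ n (suc k)) (sym (T-U-1≡U-1 (suc k))) (f4-U[1+k]-1 k))
                (b4--U-1 (suc k))
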